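{- For every integer $m\ge1$, every term $w_1\otimes\cdots\otimes w_{m+1}$ of $Y\cdot P^m\cdot Y\in B^{\otimes(m+1)}$ has $w_1\in\{X,Y\}$.
   Context: Let $\mathcal M=\mathbb Z\langle y,n\rangle/(yn=ny=n,\ n^2=0,\ y^2=y)$. In the ring $\mathcal M\otimes\mathcal M$ (tensor over $\mathbb Z$, with $(a\otimes b)(c\otimes d)=ac\otimes bd$) put $X=y\otimes n+n\otimes y$, $Y=y\otimes y$, $Z=n\otimes n$, and let $B$ be the $\mathbb Z$-span of $X,Y,Z$: a commutative subring, free abelian with basis $X,Y,Z$, with $X^2=2Z$, $Y^2=Y$, $Z^2=0$, $XY=YX=X$, $XZ=ZX=0$, $YZ=ZY=Z$. For $r\ge1$, $B^{\otimes r}$ is free abelian with basis the words $w_1\otimes\cdots\otimes w_r$, $w_i\in\{X,Y,Z\}$; writing $u\in B^{\otimes r}$ uniquely as $\sum_w c_w w$, a term of $u$ is a word $w$ with $c_w\ne0$, and $c_w$ is its coefficient. The chaining product $B^{\otimes r}\times B^{\otimes s}\to B^{\otimes(r+s-1)}$ is the bilinear (associative) map $(a_1\otimes\cdots\otimes a_r)\cdot(b_1\otimes\cdots\otimes b_s)=a_1\otimes\cdots\otimes a_{r-1}\otimes(a_rb_1)\otimes b_2\otimes\cdots\otimes b_s$. Elements of $B$ are regarded as elements of $B^{\otimes1}$. Let $P=X\otimes Y+Y\otimes X\in B^{\otimes2}$ and let $P^m\in B^{\otimes(m+1)}$ be its $m$-fold chaining product. -}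

module Defs where

open import Data.Nat using (ℕ; zero; suc; _+_; NonZero)
open import Data.Integer using (ℤ; +_; _*_) renaming (_+_ to _+ℤ_)
open import Data.List using (List; []; _∷_; foldr; map; concatMap)
open import Data.Vec using (Vec; []; _∷_)
open import Data.Vec.Properties using (≡-dec)
open import Data.Maybe using (Maybe; just; nothing)
open import Data.Product using (_×_; _,_)
open import Relation.Binary.PropositionalEquality using (_≡_; refl)
open import Relation.Binary.Definitions using (DecidableEquality)
open import Relation.Nullary using (yes; no)

data Gen : Set where
  X Y Z : Gen

_≟G_ : DecidableEquality Gen
X ≟G X = yes refl
X ≟G Y = no λ ()
X ≟G Z = no λ ()
Y ≟G X = no λ ()
Y ≟G Y = yes refl
Y ≟G Z = no λ ()
Z ≟G X = no λ ()
Z ≟G Y = no λ ()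
Z ≟G Z = yes refl

-- Multiplication table of B on basis elements: the product is either 0
-- or (coefficient , basis element).
-- X²=2Z, Y²=Y, Z²=0, XY=YX=X, XZ=ZX=0, YZ=ZY=Z.
gmul : Gen → Gen → Maybe (ℤ × Gen)
gmul X X = just (+ 2 , Z)
gmul X Y = just (+ 1 , X)
gmul X Z = nothing
gmul Y X = just (+ 1 , X)
gmul Y Y = just (+ 1 , Y)
gmul Y Z = just (+ 1 , Z)
gmul Z X = nothing
gmul Z Y = just (+ 1 , Z)
gmul Z Z = nothing

-- An element of B^{⊗n} is given by its coefficient function on basis words
-- w₁ ⊗ ⋯ ⊗ wₙ (B^{⊗n} is free abelian on these words).
Tensor : ℕ → Set
Tensor n = Vec Gen n → ℤ

words : (n : ℕ) → List (Vec Gen n)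
words zero = [] ∷ []
words (suc n) = concatMap (λ w → (X ∷ w) ∷ (Y ∷ w) ∷ (Z ∷ w) ∷ []) (words n)

sumℤ : List ℤ → ℤ
sumℤ = foldr _+ℤ_ (+ 0)

-- Chaining product of two basis words:
-- (a₁⊗⋯⊗a_{r+1})·(b₁⊗⋯⊗b_{s+1}) = a₁⊗⋯⊗a_r⊗(a_{r+1}b₁)⊗b₂⊗⋯⊗b_{s+1}.
wmul : {r s : ℕ} → Vec Gen (suc r) → Vec Gen (suc s) → Maybe (ℤ × Vec Gen (suc (r + s)))
wmul {zero} (a ∷ []) (b ∷ bs) with gmul a b
... | nothing = nothing
... | just (c , g) = just (c , g ∷ bs)
wmul {suc r} (a ∷ as) bs with wmul as bs
... | nothing = nothing
... | just (c , w) = just (c , a ∷ w)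

wcoeff : {r s : ℕ} → Vec Gen (suc r) → Vec Gen (suc s) → Vec Gen (suc (r + s)) → ℤ
wcoeff a b w with wmul a b
... | nothing = + 0
... | just (c , w') with ≡-dec _≟G_ w' w
...   | yes _ = c
...   | no _ = + 0

_⋆_ : {r s : ℕ} → Tensor (suc r) → Tensor (suc s) → Tensor (suc (r + s))
_⋆_ {r} {s} u v w =
  sumℤ (map (λ a → sumℤ (map (λ b → u a * v b * wcoeff a b w) (words (suc s)))) (words (suc r)))

infixl 7 _⋆_

basis : {n : ℕ} → Vec Gen n → Tensor n
basis w w' with ≡-dec _≟G_ w w'
... | yes _ = + 1
... | no _ = + 0

Yt : Tensor 1
Yt = basis (Y ∷ [])

P : Tensor 2
P w = basis (X ∷ Y ∷ []) w +ℤ basis (Y ∷ X ∷ []) w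

Ppow : (m : ℕ) → .{{NonZero m}} → Tensor (suc m)
Ppow (suc zero) = P
Ppow (suc (suc k)) = P ⋆ Ppow (suc k)

{-# OPTIONS --safe #-}
-- In a chaining product u ⋆ v whose left factor has length at least two, the
-- first letter of every word is the first letter of a word of u; and Y is the
-- unit of B, so Y ⋆ v has the same first letters as v. Neither term of P begins
-- with Z, hence by induction no term of P^m, of Y ⋆ P^m, or of (Y ⋆ P^m) ⋆ Y
-- does. (The length condition matters: X ⋆ X = 2Z.)
module Submission where

open import Defs
open import Data.Nat using (ℕ; zero; suc; _+_; NonZero)
open import Data.Integer using (ℤ; +_; _*_) renaming (_+_ to _+ℤ_)
open import Data.Integer.Properties using (*-zeroʳ)
open import Data.Vec using (Vec; []; _∷_; head)
open import Data.Vec.Properties using (≡-dec)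
open import Data.List using (List; []; _∷_; map)
open import Data.Maybe using (just; nothing)
open import Data.Maybe.Properties using (just-injective)
open import Data.Product using (_,_; proj₂)
open import Data.Sum using (_⊎_; inj₁; inj₂)
open import Data.Empty using (⊥-elim)
open import Relation.Nullary using (yes; no)
open import Relation.Binary.PropositionalEquality
  using (_≡_; _≢_; refl; sym; trans; cong; cong₂)

NoLeadingZ : {n : ℕ} → Tensor (suc n) → Set
NoLeadingZ u = ∀ ws → u (Z ∷ ws) ≡ + 0

sumℤ-map-zero : {A : Set} (f : A → ℤ) (xs : List A) →
                (∀ x → f x ≡ + 0) → sumℤ (map f xs) ≡ + 0
sumℤ-map-zero f []       f≡0 = refl
sumℤ-map-zero f (x ∷ xs) f≡0 rewrite f≡0 x | sumℤ-map-zero f xs f≡0 = refl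

⋆-vanishes : {r s : ℕ} (u : Tensor (suc r)) (v : Tensor (suc s)) (w : Vec Gen (suc (r + s))) →
             (∀ a b → u a ≡ + 0 ⊎ v b ≡ + 0 ⊎ wcoeff a b w ≡ + 0) → (u ⋆ v) w ≡ + 0
⋆-vanishes {r} {s} u v w factor≡0 =
  sumℤ-map-zero _ (words (suc r)) λ a → sumℤ-map-zero _ (words (suc s)) λ b → term≡0 a b
  where
  term≡0 : ∀ a b → u a * v b * wcoeff a b w ≡ + 0
  term≡0 a b with factor≡0 a b
  ... | inj₁ ua≡0        rewrite ua≡0 = refl
  ... | inj₂ (inj₁ vb≡0) rewrite vb≡0 | *-zeroʳ (u a) = refl
  ... | inj₂ (inj₂ c≡0)  rewrite c≡0 = *-zeroʳ (u a * v b)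

wcoeff-outside-product : {r s : ℕ} (a : Vec Gen (suc r)) (b : Vec Gen (suc s))
                         (w : Vec Gen (suc (r + s))) →
                         (∀ {c w′} → wmul a b ≡ just (c , w′) → w′ ≢ w) → wcoeff a b w ≡ + 0
wcoeff-outside-product a b w w∉ab with wmul a b
... | nothing = refl
... | just (c , w′) with ≡-dec _≟G_ w′ w
...   | yes w′≡w = ⊥-elim (w∉ab refl w′≡w)
...   | no _     = refl

wmul-head : {r s : ℕ} (a : Gen) (as : Vec Gen (suc r)) (b : Vec Gen (suc s)) →
            ∀ {c w} → wmul (a ∷ as) b ≡ just (c , w) → head w ≡ a
wmul-head a as b eq with wmul as b
wmul-head a as b () | nothing
wmul-head a as b refl | just _ = refl

wmul-identityˡ : {s : ℕ} (b : Vec Gen (suc s)) → wmul (Y ∷ []) b ≡ just (+ 1 , b)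
wmul-identityˡ (X ∷ bs) = refl
wmul-identityˡ (Y ∷ bs) = refl
wmul-identityˡ (Z ∷ bs) = refl

wcoeff-head-mismatch : {r s : ℕ} {a g : Gen} (as : Vec Gen (suc r)) (b : Vec Gen (suc s))
                       (ws : Vec Gen (suc (r + s))) → a ≢ g → wcoeff (a ∷ as) b (g ∷ ws) ≡ + 0
wcoeff-head-mismatch {a = a} {g} as b ws a≢g =
  wcoeff-outside-product (a ∷ as) b (g ∷ ws) λ ab w≡gws →
    a≢g (trans (sym (wmul-head a as b ab)) (cong head w≡gws))

wcoeff-identityˡ-mismatch : {s : ℕ} (b w : Vec Gen (suc s)) → b ≢ w → wcoeff (Y ∷ []) b w ≡ + 0
wcoeff-identityˡ-mismatch b w b≢w =
  wcoeff-outside-product (Y ∷ []) b w λ ab w′≡w →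
    b≢w (trans (cong proj₂ (just-injective (trans (sym (wmul-identityˡ b)) ab))) w′≡w)

NoLeadingZ-basis : {n : ℕ} (a : Gen) (as : Vec Gen n) → a ≢ Z → NoLeadingZ (basis (a ∷ as))
NoLeadingZ-basis a as a≢Z ws with ≡-dec _≟G_ (a ∷ as) (Z ∷ ws)
... | yes eq = ⊥-elim (a≢Z (cong head eq))
... | no _   = refl

NoLeadingZ-P : NoLeadingZ P
NoLeadingZ-P ws =
  cong₂ _+ℤ_ (NoLeadingZ-basis X (Y ∷ []) (λ ()) ws) (NoLeadingZ-basis Y (X ∷ []) (λ ()) ws)

NoLeadingZ-⋆ : {r s : ℕ} (u : Tensor (suc (suc r))) (v : Tensor (suc s)) →
               NoLeadingZ u → NoLeadingZ (u ⋆ v)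
NoLeadingZ-⋆ u v noZ ws = ⋆-vanishes u v (Z ∷ ws) factor≡0
  where
  factor≡0 : ∀ a b → u a ≡ + 0 ⊎ v b ≡ + 0 ⊎ wcoeff a b (Z ∷ ws) ≡ + 0
  factor≡0 (X ∷ as) b = inj₂ (inj₂ (wcoeff-head-mismatch as b ws λ ()))
  factor≡0 (Y ∷ as) b = inj₂ (inj₂ (wcoeff-head-mismatch as b ws λ ()))
  factor≡0 (Z ∷ as) b = inj₁ (noZ as)

NoLeadingZ-Y⋆ : {s : ℕ} (v : Tensor (suc s)) → NoLeadingZ v → NoLeadingZ (Yt ⋆ v)
NoLeadingZ-Y⋆ v noZ ws = ⋆-vanishes Yt v (Z ∷ ws) factor≡0
  where
  factor≡0 : ∀ a b → Yt a ≡ + 0 ⊎ v b ≡ + 0 ⊎ wcoeff a b (Z ∷ ws) ≡ + 0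
  factor≡0 (X ∷ []) b        = inj₁ refl
  factor≡0 (Z ∷ []) b        = inj₁ refl
  factor≡0 (Y ∷ []) (X ∷ bs) = inj₂ (inj₂ (wcoeff-identityˡ-mismatch (X ∷ bs) (Z ∷ ws) λ ()))
  factor≡0 (Y ∷ []) (Y ∷ bs) = inj₂ (inj₂ (wcoeff-identityˡ-mismatch (Y ∷ bs) (Z ∷ ws) λ ()))
  factor≡0 (Y ∷ []) (Z ∷ bs) = inj₂ (inj₁ (noZ bs))

NoLeadingZ-Pᵐ : (m : ℕ) → .{{_ : NonZero m}} → NoLeadingZ (Ppow m)
NoLeadingZ-Pᵐ (suc zero)    = NoLeadingZ-P
NoLeadingZ-Pᵐ (suc (suc k)) = NoLeadingZ-⋆ P (Ppow (suc k)) NoLeadingZ-P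

lemma5p3 : (m : ℕ) → .{{_ : NonZero m}} → (g : Gen) → (ws : Vec Gen (m + 0)) →
    ((Yt ⋆ Ppow m) ⋆ Yt) (g ∷ ws) ≢ + 0 → (g ≡ X) ⊎ (g ≡ Y)
lemma5p3 _       X _  _  = inj₁ refl
lemma5p3 _       Y _  _  = inj₂ refl
lemma5p3 (suc k) Z ws ≢0 = ⊥-elim (≢0 (NoLeadingZ-⋆ (Yt ⋆ Pᵐ) Yt (NoLeadingZ-Y⋆ Pᵐ noZ-Pᵐ) ws))
  where
  Pᵐ : Tensor (suc (suc k))
  Pᵐ = Ppow (suc k)

  noZ-Pᵐ : NoLeadingZ Pᵐ
  noZ-Pᵐ = NoLeadingZ-Pᵐ (suc k)
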